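{- Let $w\in D_n$ and choose $v\in[n]$. Then the total cyclic order $C_w$ is a circular extension of exactly one of the cyclic orders $C_{\sigma^v_I}$, where $I$ runs over all subsets of $[n]\setminus\{v-1,v\}$ (indices mod $n$).
   Context: Let $\mathbf P_n$ be a convex $n$-gon with vertices labeled $1,\dots,n$ clockwise. A bicolored subdivision of $\mathbf P_n$ is a partition into polygons (vertices among those of $\mathbf P_n$) colored black or white, polygons sharing an edge having different colors. For $v\in[n]$ and $I=\{i_1,\dots,i_k\}\subseteq[n]\setminus\{v-1,v\}$, the kermit subdivision $\sigma^v_I$ is the bicolored subdivision obtained by drawing the black triangles with vertices $\{v,i_\ell,i_\ell+1\}$ ($\ell=1,\dots,k$), coloring the rest white, and merging adjacent polygons of the same color. A (partial) cyclic order on a finite set $X$ is a relation $C\subseteq X^3$ that is cyclic ($(a,b,c)\in C\Rightarrow(c,a,b)\in C$), asymmetric ($(a,b,c)\in C\Rightarrow(c,b,a)\notin C$), and transitive ($(a,b,c),(a,c,d)\in C\Rightarrow(a,b,d)\in C$); it is total if for all distinct $a,b,c$ either $(a,b,c)$ or $(a,c,b)$ lies in $C$; a circular extension of $C$ is a total cyclic order containing $C$. The chain $C_{(x_1,\dots,x_m)}$ is the set of $(x_i,x_j,x_\ell)$ with $i<j<\ell$ and their cyclic rotations. For a bicolored subdivision $\sigma$, $C_\sigma$ is the union over its polygons of $C_{(v_1,\dots,v_r)}$, with $v_1,\dots,v_r$ the polygon's vertices in clockwise order if white and counterclockwise order if black. $D_n=\{w\in S_n:w_n=n\}$, and for $w=w_1\cdots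 w_n$, $C_w=C_{(w_1,\dots,w_n)}$. -}

module Defs where

open import Data.Bool using (Bool; true; false; if_then_else_)
open import Data.Empty using (⊥)
open import Data.Nat using (ℕ; zero; suc; _+_; _∸_; _%_)
open import Data.Nat.DivMod using (m%n<n)
open import Data.Fin using (Fin; toℕ; fromℕ; fromℕ<; _<_)
open import Data.Fin.Subset using (Subset; _∈_; _∉_)
open import Data.Fin.Permutation using (Permutation′; _⟨$⟩ʳ_)
open import Data.List using (List; []; _∷_; lookup; applyUpTo; reverse; tabulate)
open import Data.List.Membership.Propositional renaming (_∈_ to _∈ₗ_)
open import Data.Product using (_×_; _,_; ∃; ∃-syntax)
open import Data.Sum using (_⊎_)
open import Relation.Nullary using (¬_)
open import Relation.Binary.PropositionalEquality using (_≡_)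

Rel₃ : Set → Set₁
Rel₃ X = X → X → X → Set

_⊆₃_ : {X : Set} → Rel₃ X → Rel₃ X → Set
C ⊆₃ D = ∀ a b c → C a b c → D a b c

IsCyclic : {X : Set} → Rel₃ X → Set
IsCyclic C = ∀ a b c → C a b c → C c a b

IsAsymmetric : {X : Set} → Rel₃ X → Set
IsAsymmetric C = ∀ a b c → C a b c → ¬ C c b a

IsTransitive : {X : Set} → Rel₃ X → Set
IsTransitive C = ∀ a b c d → C a b c → C a c d → C a b d

IsCyclicOrder : {X : Set} → Rel₃ X → Set
IsCyclicOrder C = IsCyclic C × IsAsymmetric C × IsTransitive C

IsTotal : {X : Set} → Rel₃ X → Set
IsTotal C = ∀ a b c → ¬ a ≡ b → ¬ b ≡ c → ¬ a ≡ c → C a b c ⊎ C a c b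

IsTotalCyclicOrder : {X : Set} → Rel₃ X → Set
IsTotalCyclicOrder C = IsCyclicOrder C × IsTotal C

IsCircularExtensionOf : {X : Set} → Rel₃ X → Rel₃ X → Set
IsCircularExtensionOf D C = IsTotalCyclicOrder D × (C ⊆₃ D)

Chain : {X : Set} → List X → Rel₃ X
Chain xs a b c =
  ∃[ i ] ∃[ j ] ∃[ l ] (i < j) × (j < l) ×
    (  ((a , b , c) ≡ (lookup xs i , lookup xs j , lookup xs l))
     ⊎ ((a , b , c) ≡ (lookup xs l , lookup xs i , lookup xs j))
     ⊎ ((a , b , c) ≡ (lookup xs j , lookup xs l , lookup xs i)))

-- Bicoloured subdivisions of P_n.
-- Vertex k : Fin n stands for the paper's vertex k+1; vertices are
-- labelled clockwise, so clockwise order = increasing label (cyclically).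

data Color : Set where
  black white : Color

-- A polygon of a subdivision: its colour and its vertex list in
-- clockwise order.  A bicoloured subdivision is its list of polygons.
Polygon : ℕ → Set
Polygon n = Color × List (Fin n)

Subdivision : ℕ → Set
Subdivision n = List (Polygon n)

polyOrder : {n : ℕ} → Polygon n → Rel₃ (Fin n)
polyOrder (white , vs) = Chain vs
polyOrder (black , vs) = Chain (reverse vs)

Cσ : {n : ℕ} → Subdivision n → Rel₃ (Fin n)
Cσ σ a b c = ∃[ P ] (P ∈ₗ σ) × polyOrder P a b c

_⊕_ : {k : ℕ} → Fin (suc k) → ℕ → Fin (suc k)
_⊕_ {k} v t = fromℕ< (m%n<n (toℕ v + t) (suc k))

predMod : {k : ℕ} → Fin (suc k) → Fin (suc k)
predMod {k} v = v ⊕ k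

sameColor : Color → Color → Bool
sameColor black black = true
sameColor white white = true
sameColor _     _     = false

-- Merging consecutive same-coloured triangles of a fan: a list of
-- colours is grouped into maximal runs (colour, number of triangles).
consRun : Color → List (Color × ℕ) → List (Color × ℕ)
consRun c [] = (c , 1) ∷ []
consRun c ((d , m) ∷ rs) =
  if sameColor c d then (d , suc m) ∷ rs else (c , 1) ∷ (d , m) ∷ rs

runs : List Color → List (Color × ℕ)
runs [] = []
runs (c ∷ cs) = consRun c (runs cs)

-- The fan from v consists of the triangles T_t = {v, v+t, v+t+1},
-- t = 1,…,n-2 (in clockwise order); T_t is black iff v+t ∈ I.
-- Adjacent triangles T_t, T_{t+1} share the edge {v, v+t+1}.
fanColors : {k : ℕ} → Fin (suc k) → Subset (suc k) → List Color
fanColors {k} v I =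
  applyUpTo (λ s → if Data.Vec.lookup I (v ⊕ suc s) then black else white) (k ∸ 1)
  where import Data.Vec

-- The merged polygon of the run of triangles T_a,…,T_{a+m-1}:
-- vertices v, v+a, v+a+1, …, v+a+m in clockwise order.
runPolygons : {k : ℕ} → Fin (suc k) → ℕ → List (Color × ℕ) → Subdivision (suc k)
runPolygons v a [] = []
runPolygons v a ((c , m) ∷ rs) =
  (c , v ∷ applyUpTo (λ s → v ⊕ (a + s)) (suc m)) ∷ runPolygons v (a + m) rs

-- σ^v_I  (meaningful for I ⊆ [n] ∖ {v-1, v})
kermit : {k : ℕ} → Fin (suc k) → Subset (suc k) → Subdivision (suc k)
kermit v I = runPolygons v 1 (runs (fanColors v I))

-- D_n = { w ∈ S_n : w_n = n }   (n = suc k; last position/value fromℕ k)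
InD : {k : ℕ} → Permutation′ (suc k) → Set
InD {k} w = w ⟨$⟩ʳ fromℕ k ≡ fromℕ k

Cw : {n : ℕ} → Permutation′ n → Rel₃ (Fin n)
Cw w = Chain (tabulate (w ⟨$⟩ʳ_))

-- Each polygon of σ^v_I is a fan v, x₀, …, x_m, and its chain lies in C (read clockwise
-- if white, counterclockwise if black) exactly when every triangle v, x_s, x_{s+1} of
-- the fan is oriented by C in that way.  So C extends C_{σ^v_I} iff, for every vertex
-- x ∉ {v−1, v}, x ∈ I holds exactly when C reverses the triangle v, x, x+1.  This
-- prescribes I completely, and the prescribed I does give an extension.
module Submission where

open import Defs
open import Data.Bool using (Bool; true; false; if_then_else_)
open import Data.Bool.Properties using (¬-not; not-¬)
open import Data.Empty using (⊥-elim)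
open import Data.Nat using (ℕ; zero; suc; _+_; _∸_; _%_; _≤_; _<_; z≤n; s≤s; NonZero)
open import Data.Nat.Properties hiding (_≟_)
open import Data.Nat.DivMod using (%-distribˡ-+; m%n%n≡m%n; m<n⇒m%n≡m; [m+n]%n≡m%n; m%n<n)
open import Algebra.Properties.CommutativeSemigroup +-commutativeSemigroup using (x∙yz≈y∙xz; xy∙z≈y∙xz)
open import Data.Fin using (Fin; toℕ; cast; _≟_)
  renaming (zero to fzero; suc to fsuc; _<_ to _<ᶠ_)
import Data.Fin.Properties as Finₚ
open import Data.Fin.Subset using (Subset; _∉_)
import Data.Vec as Vec
import Data.Vec.Properties as Vecₚ
open import Data.List using (List; []; _∷_; lookup; length; applyUpTo; reverse; tabulate; map)
open import Data.List.Properties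
  using (lookup-applyUpTo; length-applyUpTo; lookup-tabulate; length-tabulate; reverse-involutive)
open import Data.List.Membership.Propositional using () renaming (_∈_ to _∈ₗ_)
open import Data.List.Membership.Propositional.Properties using (∈-lookup; ∈-map⁺; ∈-map⁻)
open import Data.List.Relation.Unary.Any as Any using (here; there)
import Data.List.Relation.Unary.Any.Properties as Anyₚ
open import Data.List.Relation.Binary.Sublist.Heterogeneous using (Sublist; []; _∷_; _∷ʳ_; minimum; fromAny; toAny)
open import Data.List.Relation.Binary.Sublist.Heterogeneous.Properties using (reverse⁺)
open import Data.Product using (_×_; _,_; ∃-syntax; proj₁; proj₂)
open import Data.Sum as Sum using (_⊎_; inj₁; inj₂)
open import Data.Fin.Permutation using (Permutation′; _⟨$⟩ʳ_; _⟨$⟩ˡ_; inverseˡ; inverseʳ)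
open import Function using (_∘_; id)
open import Function.Definitions using (Injective)
open import Relation.Nullary using (¬_; yes; no)
open import Relation.Binary using (tri<; tri≈; tri>)
open import Relation.Binary.PropositionalEquality

Between : ℕ → ℕ → ℕ → Set
Between p q r = (p < q × q < r) ⊎ (q < r × r < p) ⊎ (r < p × p < q)

between-cyclic : IsCyclic Between
between-cyclic p q r (inj₁ x)        = inj₂ (inj₁ x)
between-cyclic p q r (inj₂ (inj₁ x)) = inj₂ (inj₂ x)
between-cyclic p q r (inj₂ (inj₂ x)) = inj₁ x

between-asymmetric : IsAsymmetric Between
between-asymmetric p q r (inj₁ (a , b))        (inj₁ (c , d))        = <-asym a d
between-asymmetric p q r (inj₁ (a , b))        (inj₂ (inj₁ (c , d))) = <-asym a c
between-asymmetric p q r (inj₁ (a , b))        (inj₂ (inj₂ (c , d))) = <-asym b d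
between-asymmetric p q r (inj₂ (inj₁ (a , b))) (inj₁ (c , d))        = <-asym a c
between-asymmetric p q r (inj₂ (inj₁ (a , b))) (inj₂ (inj₁ (c , d))) = <-asym b d
between-asymmetric p q r (inj₂ (inj₁ (a , b))) (inj₂ (inj₂ (c , d))) = <-asym a d
between-asymmetric p q r (inj₂ (inj₂ (a , b))) (inj₁ (c , d))        = <-asym b d
between-asymmetric p q r (inj₂ (inj₂ (a , b))) (inj₂ (inj₁ (c , d))) = <-asym a d
between-asymmetric p q r (inj₂ (inj₂ (a , b))) (inj₂ (inj₂ (c , d))) = <-asym a c

between-transitive : IsTransitive Between
between-transitive p q r s (inj₁ (a , b))        (inj₁ (c , d))        = inj₁ (a , <-trans b d)
between-transitive p q r s (inj₁ (a , b))        (inj₂ (inj₁ (c , d))) = ⊥-elim (<-asym (<-trans a b) (<-trans c d))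
between-transitive p q r s (inj₁ (a , b))        (inj₂ (inj₂ (c , d))) = inj₂ (inj₂ (c , a))
between-transitive p q r s (inj₂ (inj₁ (a , b))) (inj₁ (c , d))        = ⊥-elim (<-asym b c)
between-transitive p q r s (inj₂ (inj₁ (a , b))) (inj₂ (inj₁ (c , d))) = inj₂ (inj₁ (<-trans a c , d))
between-transitive p q r s (inj₂ (inj₁ (a , b))) (inj₂ (inj₂ (c , d))) = ⊥-elim (<-asym b d)
between-transitive p q r s (inj₂ (inj₂ (a , b))) (inj₁ (c , d))        = ⊥-elim (<-asym a c)
between-transitive p q r s (inj₂ (inj₂ (a , b))) (inj₂ (inj₁ (c , d))) = inj₂ (inj₂ (d , b))
between-transitive p q r s (inj₂ (inj₂ (a , b))) (inj₂ (inj₂ (c , d))) = ⊥-elim (<-asym a d)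

between-total : IsTotal Between
between-total p q r p≢q q≢r p≢r with <-cmp p q | <-cmp q r | <-cmp p r
... | tri≈ _ e _ | _          | _          = ⊥-elim (p≢q e)
... | _          | tri≈ _ e _ | _          = ⊥-elim (q≢r e)
... | _          | _          | tri≈ _ e _ = ⊥-elim (p≢r e)
... | tri< a _ _ | tri< b _ _ | _          = inj₁ (inj₁ (a , b))
... | tri< _ _ _ | tri> _ _ b | tri< c _ _ = inj₂ (inj₁ (c , b))
... | tri< a _ _ | tri> _ _ _ | tri> _ _ c = inj₁ (inj₂ (inj₂ (c , a)))
... | tri> _ _ a | tri< _ _ _ | tri< c _ _ = inj₂ (inj₂ (inj₂ (a , c)))
... | tri> _ _ _ | tri< b _ _ | tri> _ _ c = inj₁ (inj₂ (inj₁ (b , c)))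
... | tri> _ _ a | tri> _ _ b | _          = inj₂ (inj₂ (inj₁ (b , a)))

between-isTotalCyclicOrder : IsTotalCyclicOrder Between
between-isTotalCyclicOrder =
  (between-cyclic , between-asymmetric , between-transitive) , between-total

Preimage : {X Y : Set} → (X → Y) → Rel₃ Y → Rel₃ X
Preimage f D a b c = D (f a) (f b) (f c)

preimage-isTotalCyclicOrder : {X Y : Set} {D : Rel₃ Y} (f : X → Y) → Injective _≡_ _≡_ f →
  IsTotalCyclicOrder D → IsTotalCyclicOrder (Preimage f D)
preimage-isTotalCyclicOrder f f-inj ((cyc , asym , trans′) , total) =
  ( (λ a b c → cyc (f a) (f b) (f c))
  , (λ a b c → asym (f a) (f b) (f c))
  , (λ a b c d → trans′ (f a) (f b) (f c) (f d)))
  , λ a b c a≢b b≢c a≢c → total (f a) (f b) (f c) (a≢b ∘ f-inj) (b≢c ∘ f-inj) (a≢c ∘ f-inj)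

isTotalCyclicOrder-resp : {X : Set} {C D : Rel₃ X} → C ⊆₃ D → D ⊆₃ C →
  IsTotalCyclicOrder D → IsTotalCyclicOrder C
isTotalCyclicOrder-resp C⊆D D⊆C ((cyc , asym , trans′) , total) =
  ( (λ a b c → D⊆C c a b ∘ cyc a b c ∘ C⊆D a b c)
  , (λ a b c h h′ → asym a b c (C⊆D a b c h) (C⊆D c b a h′))
  , (λ a b c d h h′ → D⊆C a b d (trans′ a b c d (C⊆D a b c h) (C⊆D a c d h′))))
  , λ a b c a≢b b≢c a≢c → Sum.map (D⊆C a b c) (D⊆C a c b) (total a b c a≢b b≢c a≢c)

-- Chains of lists

Chain-cyclic : {X : Set} (xs : List X) → IsCyclic (Chain xs)
Chain-cyclic xs a b c (i , j , l , i<j , j<l , inj₁ refl)        = i , j , l , i<j , j<l , inj₂ (inj₁ refl)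
Chain-cyclic xs a b c (i , j , l , i<j , j<l , inj₂ (inj₁ refl)) = i , j , l , i<j , j<l , inj₂ (inj₂ refl)
Chain-cyclic xs a b c (i , j , l , i<j , j<l , inj₂ (inj₂ refl)) = i , j , l , i<j , j<l , inj₁ refl

increasing⇒Chain⊆ : {X : Set} {D : Rel₃ X} (xs : List X) → IsCyclic D →
  (∀ i j l → i <ᶠ j → j <ᶠ l → D (lookup xs i) (lookup xs j) (lookup xs l)) → Chain xs ⊆₃ D
increasing⇒Chain⊆ xs cyc increasing a b c (i , j , l , i<j , j<l , inj₁ refl) =
  increasing i j l i<j j<l
increasing⇒Chain⊆ xs cyc increasing a b c (i , j , l , i<j , j<l , inj₂ (inj₁ refl)) =
  cyc _ _ _ (increasing i j l i<j j<l)
increasing⇒Chain⊆ xs cyc increasing a b c (i , j , l , i<j , j<l , inj₂ (inj₂ refl)) =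
  cyc _ _ _ (cyc _ _ _ (increasing i j l i<j j<l))

Chain-isTotalCyclicOrder : {X : Set} (xs : List X) (index : X → Fin (length xs)) →
  (∀ a → lookup xs (index a) ≡ a) → (∀ i → index (lookup xs i) ≡ i) →
  IsTotalCyclicOrder (Chain xs)
Chain-isTotalCyclicOrder xs index lookup-index index-lookup =
  isTotalCyclicOrder-resp Chain⇒Between Between⇒Chain
    (preimage-isTotalCyclicOrder position position-injective between-isTotalCyclicOrder)
  where
  position = toℕ ∘ index

  position-injective : Injective _≡_ _≡_ position
  position-injective {a} {b} e = begin
    a                      ≡⟨ lookup-index a ⟨
    lookup xs (index a)    ≡⟨ cong (lookup xs) (Finₚ.toℕ-injective e) ⟩
    lookup xs (index b)    ≡⟨ lookup-index b ⟩
    b                      ∎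
    where open ≡-Reasoning

  Chain⇒Between : Chain xs ⊆₃ Preimage position Between
  Chain⇒Between = increasing⇒Chain⊆ xs (λ a b c → between-cyclic _ _ _) increasing
    where
    increasing : ∀ i j l → i <ᶠ j → j <ᶠ l →
      Between (position (lookup xs i)) (position (lookup xs j)) (position (lookup xs l))
    increasing i j l i<j j<l rewrite index-lookup i | index-lookup j | index-lookup l =
      inj₁ (i<j , j<l)

  looked-up : ∀ a b c → (a , b , c) ≡ (lookup xs (index a) , lookup xs (index b) , lookup xs (index c))
  looked-up a b c = sym (cong₂ _,_ (lookup-index a) (cong₂ _,_ (lookup-index b) (lookup-index c)))

  Between⇒Chain : Preimage position Between ⊆₃ Chain xs
  Between⇒Chain a b c (inj₁ (p , q)) =
    index a , index b , index c , p , q , inj₁ (looked-up a b c)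
  Between⇒Chain a b c (inj₂ (inj₁ (p , q))) =
    index b , index c , index a , p , q , inj₂ (inj₁ (looked-up a b c))
  Between⇒Chain a b c (inj₂ (inj₂ (p , q))) =
    index c , index a , index b , p , q , inj₂ (inj₂ (looked-up a b c))

Cw-isTotalCyclicOrder : {n : ℕ} (w : Permutation′ n) → IsTotalCyclicOrder (Cw w)
Cw-isTotalCyclicOrder w =
  Chain-isTotalCyclicOrder (tabulate (w ⟨$⟩ʳ_)) index lookup-index index-lookup
  where
  length≡ = length-tabulate (w ⟨$⟩ʳ_)

  index : _ → Fin (length (tabulate (w ⟨$⟩ʳ_)))
  index a = cast (sym length≡) (w ⟨$⟩ˡ a)

  lookup-index : ∀ a → lookup (tabulate (w ⟨$⟩ʳ_)) (index a) ≡ a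
  lookup-index a = trans (lookup-tabulate (w ⟨$⟩ʳ_) (w ⟨$⟩ˡ a)) (inverseʳ w)

  index-lookup : ∀ i → index (lookup (tabulate (w ⟨$⟩ʳ_)) i) ≡ i
  index-lookup i = begin
    index (lookup (tabulate (w ⟨$⟩ʳ_)) i)
      ≡⟨ cong (index ∘ lookup (tabulate (w ⟨$⟩ʳ_))) (Finₚ.cast-involutive (sym length≡) length≡ i) ⟨
    index (lookup (tabulate (w ⟨$⟩ʳ_)) (cast (sym length≡) (cast length≡ i)))
      ≡⟨ cong index (lookup-tabulate (w ⟨$⟩ʳ_) (cast length≡ i)) ⟩
    cast (sym length≡) (w ⟨$⟩ˡ (w ⟨$⟩ʳ cast length≡ i))
      ≡⟨ cong (cast (sym length≡)) (inverseˡ w) ⟩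
    cast (sym length≡) (cast length≡ i)
      ≡⟨ Finₚ.cast-involutive (sym length≡) length≡ i ⟩
    i ∎
    where open ≡-Reasoning

Ordered : {X : Set} → List X → X → X → X → Set
Ordered xs a b c = Sublist _≡_ (a ∷ b ∷ c ∷ []) xs

lookup-sublist₂ : {X : Set} (xs : List X) {i j : Fin (length xs)} → i <ᶠ j →
  Sublist _≡_ (lookup xs i ∷ lookup xs j ∷ []) xs
lookup-sublist₂ (x ∷ xs) {fzero}  {fsuc j} _         = refl ∷ fromAny (∈-lookup j)
lookup-sublist₂ (x ∷ xs) {fsuc i} {fsuc j} (s≤s i<j) = x ∷ʳ lookup-sublist₂ xs i<j

lookup-ordered : {X : Set} (xs : List X) {i j l : Fin (length xs)} → i <ᶠ j → j <ᶠ l →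
  Ordered xs (lookup xs i) (lookup xs j) (lookup xs l)
lookup-ordered (x ∷ xs) {fzero}  {fsuc j} {fsuc l} _         (s≤s j<l) = refl ∷ lookup-sublist₂ xs j<l
lookup-ordered (x ∷ xs) {fsuc i} {fsuc j} {fsuc l} (s≤s i<j) (s≤s j<l) = x ∷ʳ lookup-ordered xs i<j j<l

sublist₂-lookup : {X : Set} (xs : List X) {a b : X} → Sublist _≡_ (a ∷ b ∷ []) xs →
  ∃[ i ] ∃[ j ] (i <ᶠ j × a ≡ lookup xs i × b ≡ lookup xs j)
sublist₂-lookup (x ∷ xs) (refl ∷ p) =
  fzero , fsuc (Any.index (toAny p)) , s≤s z≤n , refl , Anyₚ.lookup-index (toAny p)
sublist₂-lookup (x ∷ xs) (.x ∷ʳ p) with sublist₂-lookup xs p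
... | i , j , i<j , e₁ , e₂ = fsuc i , fsuc j , s≤s i<j , e₁ , e₂

ordered⇒Chain : {X : Set} (xs : List X) {a b c : X} → Ordered xs a b c → Chain xs a b c
ordered⇒Chain (x ∷ xs) (refl ∷ p) with sublist₂-lookup xs p
... | j , l , j<l , refl , refl = fzero , fsuc j , fsuc l , s≤s z≤n , s≤s j<l , inj₁ refl
ordered⇒Chain (x ∷ xs) (.x ∷ʳ p) with ordered⇒Chain xs p
... | i , j , l , i<j , j<l , e = fsuc i , fsuc j , fsuc l , s≤s i<j , s≤s j<l , e

Chain-reverse : {X : Set} (xs : List X) {a b c : X} → Chain xs a b c → Chain (reverse xs) c b a
Chain-reverse xs = increasing⇒Chain⊆ xs reversed-cyclic reversed-increasing _ _ _
  where
  reversed-increasing : ∀ i j l → i <ᶠ j → j <ᶠ l → Chain (reverse xs) (lookup xs l) (lookup xs j) (lookup xs i)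
  reversed-increasing i j l i<j j<l = ordered⇒Chain (reverse xs) (reverse⁺ (lookup-ordered xs i<j j<l))

  reversed-cyclic : IsCyclic (λ a b c → Chain (reverse xs) c b a)
  reversed-cyclic a b c = Chain-cyclic (reverse xs) _ _ _ ∘ Chain-cyclic (reverse xs) _ _ _

Chain-reverse⁻ : {X : Set} (xs : List X) {a b c : X} → Chain (reverse xs) a b c → Chain xs c b a
Chain-reverse⁻ xs = subst (λ ys → Chain ys _ _ _) (reverse-involutive xs) ∘ Chain-reverse (reverse xs)

applyUpTo-sublist₂ : {X : Set} (h : ℕ → X) {s m : ℕ} → s < m →
  Sublist _≡_ (h s ∷ h (suc s) ∷ []) (applyUpTo h (suc m))
applyUpTo-sublist₂ h {zero}  {suc m} _         = refl ∷ refl ∷ minimum _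
applyUpTo-sublist₂ h {suc s} {suc m} (s≤s s<m) = h 0 ∷ʳ applyUpTo-sublist₂ (h ∘ suc) s<m

fan-edge∈Chain : {X : Set} (v : X) (h : ℕ → X) {s m : ℕ} → s < m →
  Chain (v ∷ applyUpTo h (suc m)) v (h s) (h (suc s))
fan-edge∈Chain v h s<m = ordered⇒Chain (v ∷ _) (refl ∷ applyUpTo-sublist₂ h s<m)

-- Fans in a total cyclic order

Flip : {X : Set} → Rel₃ X → Rel₃ X
Flip C a b c = C c b a

-- How C must order the triangle a, x, y for it to lie in a polygon of the given colour.
Oriented : {X : Set} → Rel₃ X → Color → X → X → X → Set
Oriented C white a x y = C a x y
Oriented C black a x y = C a y x

module TotalCyclicOrder {X : Set} {C : Rel₃ X} (isTCO : IsTotalCyclicOrder C) where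

  cyclic : IsCyclic C
  cyclic = proj₁ (proj₁ isTCO)

  asymmetric : IsAsymmetric C
  asymmetric = proj₁ (proj₂ (proj₁ isTCO))

  transitive : IsTransitive C
  transitive = proj₂ (proj₂ (proj₁ isTCO))

  total : IsTotal C
  total = proj₂ isTCO

  rotate² : ∀ {a b c} → C a b c → C b c a
  rotate² h = cyclic _ _ _ (cyclic _ _ _ h)

  distinct₁₂ : ∀ {a b c} → C a b c → ¬ a ≡ b
  distinct₁₂ h refl = asymmetric _ _ _ h (cyclic _ _ _ h)

  distinct₂₃ : ∀ {a b c} → C a b c → ¬ b ≡ c
  distinct₂₃ h refl = distinct₁₂ (rotate² h) refl

  flip-isTotalCyclicOrder : IsTotalCyclicOrder (Flip C)
  flip-isTotalCyclicOrder =
    ( (λ a b c → rotate²)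
    , (λ a b c h h′ → asymmetric c b a h h′)
    , (λ a b c d h h′ → rotate² (transitive a d c b (cyclic _ _ _ h′) (cyclic _ _ _ h))))
    , λ a b c a≢b b≢c a≢c →
        Sum.map₂ (cyclic c a b) (total c b a (b≢c ∘ sym) (a≢b ∘ sym) (a≢c ∘ sym))

  Oriented-unique : ∀ {c c′ v x y} → Oriented C c v x y → Oriented C c′ v x y → c ≡ c′
  Oriented-unique {white} {white} _ _  = refl
  Oriented-unique {black} {black} _ _  = refl
  Oriented-unique {white} {black} h h′ = ⊥-elim (asymmetric _ _ _ h (rotate² h′))
  Oriented-unique {black} {white} h h′ = ⊥-elim (asymmetric _ _ _ h′ (rotate² h))

  triangle : ∀ {v x y z} → C v x y → C v y z → C x y z
  triangle {v} {x} {y} {z} vxy vyz =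
    Sum.[ id , ⊥-elim ∘ reversed ]′ (total x y z (distinct₂₃ vxy) (distinct₂₃ vyz) x≢z)
    where
    x≢z : ¬ x ≡ z
    x≢z refl = asymmetric v x y vxy (rotate² vyz)

    reversed : ¬ C x z y
    reversed xzy = asymmetric v y z vyz (cyclic y v z (transitive y v x z (cyclic v x y vxy) (cyclic x z y xzy)))

  fan-monotone : ∀ {v} (h : ℕ → X) {m} → (∀ s → s < m → C v (h s) (h (suc s))) →
    ∀ {x y} → x < y → y ≤ m → C v (h x) (h y)
  fan-monotone {v} h fan {x} {suc y} (s≤s x≤y) y<m with m≤n⇒m<n∨m≡n x≤y
  ... | inj₂ refl = fan x y<m
  ... | inj₁ x<y  = transitive v (h x) (h y) (h (suc y)) (fan-monotone h fan x<y (<⇒≤ y<m)) (fan y y<m)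

  Chain-fan⊆ : ∀ {v} (h : ℕ → X) {m} → (∀ s → s < m → C v (h s) (h (suc s))) →
    Chain (v ∷ applyUpTo h (suc m)) ⊆₃ C
  Chain-fan⊆ {v} h {m} fan = increasing⇒Chain⊆ (v ∷ hs) cyclic increasing
    where
    hs = applyUpTo h (suc m)

    at : ∀ i → lookup hs i ≡ h (toℕ i)
    at = lookup-applyUpTo h (suc m)

    bound : ∀ i → toℕ {length hs} i ≤ m
    bound i = ≤-pred (subst (toℕ i <_) (length-applyUpTo h (suc m)) (Finₚ.toℕ<n i))

    increasing : ∀ i j l → i <ᶠ j → j <ᶠ l → C (lookup (v ∷ hs) i) (lookup (v ∷ hs) j) (lookup (v ∷ hs) l)
    increasing fzero    (fsuc j) (fsuc l) _         (s≤s j<l) rewrite at j | at l =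
      fan-monotone h fan j<l (bound l)
    increasing (fsuc i) (fsuc j) (fsuc l) (s≤s i<j) (s≤s j<l) rewrite at i | at j | at l =
      triangle (fan-monotone h fan i<j (bound j)) (fan-monotone h fan j<l (bound l))

module _ {n : ℕ} {C : Rel₃ (Fin n)} (isTCO : IsTotalCyclicOrder C) where
  open TotalCyclicOrder isTCO
  private module Flipped = TotalCyclicOrder flip-isTotalCyclicOrder

  fan-oriented⇒polyOrder⊆ : ∀ c v (h : ℕ → Fin n) {m} →
    (∀ s → s < m → Oriented C c v (h s) (h (suc s))) → polyOrder (c , v ∷ applyUpTo h (suc m)) ⊆₃ C
  fan-oriented⇒polyOrder⊆ white v h fan = Chain-fan⊆ h fan
  fan-oriented⇒polyOrder⊆ black v h fan a b c =
    Flipped.Chain-fan⊆ h (λ s s<m → rotate² (fan s s<m)) c b a ∘ Chain-reverse⁻ (v ∷ applyUpTo h _)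

  polyOrder⊆⇒fan-oriented : ∀ c v (h : ℕ → Fin n) {m} →
    polyOrder (c , v ∷ applyUpTo h (suc m)) ⊆₃ C → ∀ s → s < m → Oriented C c v (h s) (h (suc s))
  polyOrder⊆⇒fan-oriented white v h P⊆C s s<m = P⊆C _ _ _ (fan-edge∈Chain v h s<m)
  polyOrder⊆⇒fan-oriented black v h P⊆C s s<m = P⊆C _ _ _ (Chain-reverse (v ∷ applyUpTo h _) edge)
    where
    edge = Chain-cyclic _ _ _ _ (Chain-cyclic _ _ _ _ (fan-edge∈Chain v h s<m))

-- Vertex arithmetic modulo n

[m%d+n]%d≡[m+n]%d : ∀ m n d .{{_ : NonZero d}} → (m % d + n) % d ≡ (m + n) % d
[m%d+n]%d≡[m+n]%d m n d = begin
  (m % d + n) % d          ≡⟨ %-distribˡ-+ (m % d) n d ⟩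
  (m % d % d + n % d) % d  ≡⟨ cong (λ r → (r + n % d) % d) (m%n%n≡m%n m d) ⟩
  (m % d + n % d) % d      ≡⟨ %-distribˡ-+ m n d ⟨
  (m + n) % d              ∎
  where open ≡-Reasoning

[m+n%d]%d≡[m+n]%d : ∀ m n d .{{_ : NonZero d}} → (m + n % d) % d ≡ (m + n) % d
[m+n%d]%d≡[m+n]%d m n d = begin
  (m + n % d) % d  ≡⟨ cong (_% d) (+-comm m (n % d)) ⟩
  (n % d + m) % d  ≡⟨ [m%d+n]%d≡[m+n]%d n m d ⟩
  (n + m) % d      ≡⟨ cong (_% d) (+-comm n m) ⟩
  (m + n) % d      ∎
  where open ≡-Reasoning

toℕ-⊕ : ∀ {k} (v : Fin (suc k)) t → toℕ (v ⊕ t) ≡ (toℕ v + t) % suc k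
toℕ-⊕ v t = Finₚ.toℕ-fromℕ< _

module _ {k : ℕ} (v : Fin (suc k)) where

  ⊕-zero : v ⊕ 0 ≡ v
  ⊕-zero = Finₚ.toℕ-injective (begin
    toℕ (v ⊕ 0)        ≡⟨ toℕ-⊕ v 0 ⟩
    (toℕ v + 0) % suc k ≡⟨ cong (_% suc k) (+-identityʳ (toℕ v)) ⟩
    toℕ v % suc k       ≡⟨ m<n⇒m%n≡m (Finₚ.toℕ<n v) ⟩
    toℕ v               ∎)
    where open ≡-Reasoning

  ⊕-suc : ∀ t → (v ⊕ t) ⊕ 1 ≡ v ⊕ suc t
  ⊕-suc t = Finₚ.toℕ-injective (begin
    toℕ ((v ⊕ t) ⊕ 1)             ≡⟨ toℕ-⊕ (v ⊕ t) 1 ⟩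
    (toℕ (v ⊕ t) + 1) % suc k      ≡⟨ cong (λ r → (r + 1) % suc k) (toℕ-⊕ v t) ⟩
    ((toℕ v + t) % suc k + 1) % suc k ≡⟨ [m%d+n]%d≡[m+n]%d (toℕ v + t) 1 (suc k) ⟩
    (toℕ v + t + 1) % suc k        ≡⟨ cong (_% suc k) (trans (+-comm _ 1) (sym (+-suc (toℕ v) t))) ⟩
    (toℕ v + suc t) % suc k        ≡⟨ toℕ-⊕ v (suc t) ⟨
    toℕ (v ⊕ suc t)                ∎)
    where open ≡-Reasoning

  offset : Fin (suc k) → ℕ
  offset x = (toℕ x + (suc k ∸ toℕ v)) % suc k

  offset<n : ∀ x → offset x < suc k
  offset<n x = m%n<n (toℕ x + (suc k ∸ toℕ v)) (suc k)

  private
    v+[n∸v]≡n : toℕ v + (suc k ∸ toℕ v) ≡ suc k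
    v+[n∸v]≡n = m+[n∸m]≡n (<⇒≤ (Finₚ.toℕ<n v))

  offset-⊕ : ∀ t → t < suc k → offset (v ⊕ t) ≡ t
  offset-⊕ t t<n = begin
    (toℕ (v ⊕ t) + (suc k ∸ toℕ v)) % suc k       ≡⟨ cong (λ r → (r + (suc k ∸ toℕ v)) % suc k) (toℕ-⊕ v t) ⟩
    ((toℕ v + t) % suc k + (suc k ∸ toℕ v)) % suc k ≡⟨ [m%d+n]%d≡[m+n]%d (toℕ v + t) _ (suc k) ⟩
    (toℕ v + t + (suc k ∸ toℕ v)) % suc k          ≡⟨ cong (_% suc k) (xy∙z≈y∙xz (toℕ v) t _) ⟩
    (t + (toℕ v + (suc k ∸ toℕ v))) % suc k        ≡⟨ cong (λ r → (t + r) % suc k) v+[n∸v]≡n ⟩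
    (t + suc k) % suc k                            ≡⟨ [m+n]%n≡m%n t (suc k) ⟩
    t % suc k                                      ≡⟨ m<n⇒m%n≡m t<n ⟩
    t                                              ∎
    where open ≡-Reasoning

  ⊕-offset : ∀ x → v ⊕ offset x ≡ x
  ⊕-offset x = Finₚ.toℕ-injective (begin
    toℕ (v ⊕ offset x)                            ≡⟨ toℕ-⊕ v (offset x) ⟩
    (toℕ v + offset x) % suc k                     ≡⟨ [m+n%d]%d≡[m+n]%d (toℕ v) _ (suc k) ⟩
    (toℕ v + (toℕ x + (suc k ∸ toℕ v))) % suc k    ≡⟨ cong (_% suc k) (x∙yz≈y∙xz (toℕ v) (toℕ x) _) ⟩
    (toℕ x + (toℕ v + (suc k ∸ toℕ v))) % suc k    ≡⟨ cong (λ r → (toℕ x + r) % suc k) v+[n∸v]≡n ⟩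
    (toℕ x + suc k) % suc k                        ≡⟨ [m+n]%n≡m%n (toℕ x) (suc k) ⟩
    toℕ x % suc k                                  ≡⟨ m<n⇒m%n≡m (Finₚ.toℕ<n x) ⟩
    toℕ x                                          ∎)
    where open ≡-Reasoning

  ⊕-period : v ⊕ suc k ≡ v
  ⊕-period = Finₚ.toℕ-injective (begin
    toℕ (v ⊕ suc k)           ≡⟨ toℕ-⊕ v (suc k) ⟩
    (toℕ v + suc k) % suc k    ≡⟨ [m+n]%n≡m%n (toℕ v) (suc k) ⟩
    toℕ v % suc k              ≡⟨ m<n⇒m%n≡m (Finₚ.toℕ<n v) ⟩
    toℕ v                      ∎)
    where open ≡-Reasoning

  predMod-⊕1 : predMod v ⊕ 1 ≡ v
  predMod-⊕1 = trans (⊕-suc k) ⊕-period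

  ⊕-injective : ∀ {t s} → t < suc k → s < suc k → v ⊕ t ≡ v ⊕ s → t ≡ s
  ⊕-injective {t} {s} t<n s<n e = trans (sym (offset-⊕ t t<n)) (trans (cong offset e) (offset-⊕ s s<n))

  ⊕-distinct : ∀ {t s} → t < s → s < suc k → ¬ v ⊕ t ≡ v ⊕ s
  ⊕-distinct t<s s<n e = <-irrefl (⊕-injective (<-trans t<s s<n) s<n e) t<s

-- Kermit subdivisions

-- The run of `size` consecutive fan triangles starting with T_start, merged into one polygon.
record Block : Set where
  constructor block
  field
    colour : Color
    start  : ℕ
    size   : ℕ
open Block

blocks : ℕ → List (Color × ℕ) → List Block
blocks a []             = []
blocks a ((c , m) ∷ rs) = block c a m ∷ blocks (a + m) rs

sameColor⇒≡ : ∀ {c d} → sameColor c d ≡ true → c ≡ d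
sameColor⇒≡ {black} {black} _ = refl
sameColor⇒≡ {white} {white} _ = refl

blocks-consRun⁻ : ∀ c R a {B} → B ∈ₗ blocks a (consRun c R) →
  B ≡ block c a 1
  ⊎ (∃[ m ] B ≡ block c a (suc m) × block c (suc a) m ∈ₗ blocks (suc a) R)
  ⊎ B ∈ₗ blocks (suc a) R
blocks-consRun⁻ c [] a (here e) = inj₁ e
blocks-consRun⁻ c ((d , m) ∷ R) a B∈ with sameColor c d in same
blocks-consRun⁻ c ((d , m) ∷ R) a (here e)   | true rewrite sameColor⇒≡ same = inj₂ (inj₁ (m , e , here refl))
blocks-consRun⁻ c ((d , m) ∷ R) a (there B∈) | true rewrite +-suc a m = inj₂ (inj₂ (there B∈))
blocks-consRun⁻ c ((d , m) ∷ R) a (here e)   | false = inj₁ e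
blocks-consRun⁻ c ((d , m) ∷ R) a (there B∈) | false rewrite +-comm a 1 = inj₂ (inj₂ B∈)

blocks-runs-monochromatic : ∀ (g : ℕ → Color) L a {B} → B ∈ₗ blocks a (runs (applyUpTo g L)) →
  ∃[ o ] (start B ≡ a + o × o + size B ≤ L × (∀ s → s < size B → g (o + s) ≡ colour B))
blocks-runs-monochromatic g (suc L) a B∈ with blocks-consRun⁻ (g 0) (runs (applyUpTo (g ∘ suc) L)) a B∈
... | inj₁ refl = 0 , sym (+-identityʳ a) , s≤s z≤n , λ { zero _ → refl ; (suc _) (s≤s ()) }
... | inj₂ (inj₁ (m , refl , first∈)) with blocks-runs-monochromatic (g ∘ suc) L (suc a) first∈
...   | o , start≡ , bound , mono with +-cancelˡ-≡ (suc a) o 0 (trans (sym start≡) (sym (+-identityʳ (suc a))))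
...     | refl = 0 , sym (+-identityʳ a) , s≤s bound , λ { zero _ → refl ; (suc s) (s≤s s<m) → mono s s<m }
blocks-runs-monochromatic g (suc L) a B∈ | inj₂ (inj₂ B∈′)
  with blocks-runs-monochromatic (g ∘ suc) L (suc a) B∈′
... | o , start≡ , bound , mono = suc o , trans start≡ (sym (+-suc a o)) , s≤s bound , mono

blocks-consRun-head : ∀ c R a → ∃[ B ] (B ∈ₗ blocks a (consRun c R) × start B ≡ a × 0 < size B)
blocks-consRun-head c []            a = _ , here refl , refl , s≤s z≤n
blocks-consRun-head c ((d , m) ∷ R) a with sameColor c d
... | true  = _ , here refl , refl , s≤s z≤n
... | false = _ , here refl , refl , s≤s z≤n

blocks-consRun⁺ : ∀ c R a {B} → B ∈ₗ blocks (suc a) R →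
  ∃[ B′ ] (B′ ∈ₗ blocks a (consRun c R) × start B′ ≤ start B × start B + size B ≤ start B′ + size B′)
blocks-consRun⁺ c ((d , m) ∷ R) a B∈ with sameColor c d
blocks-consRun⁺ c ((d , m) ∷ R) a (here refl) | true =
  _ , here refl , n≤1+n a , ≤-reflexive (sym (+-suc a m))
blocks-consRun⁺ c ((d , m) ∷ R) a (there B∈) | true rewrite sym (+-suc a m) =
  _ , there B∈ , ≤-refl , ≤-refl
blocks-consRun⁺ c ((d , m) ∷ R) a {B} B∈ | false =
  B , there (subst (λ a′ → B ∈ₗ blocks a′ ((d , m) ∷ R)) (+-comm 1 a) B∈) , ≤-refl , ≤-refl

blocks-runs-covering : ∀ (g : ℕ → Color) L a {s} → s < L →
  ∃[ B ] (B ∈ₗ blocks a (runs (applyUpTo g L)) × start B ≤ a + s × a + s < start B + size B)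
blocks-runs-covering g (suc L) a {zero} _ with blocks-consRun-head (g 0) (runs (applyUpTo (g ∘ suc) L)) a
... | B , B∈ , refl , 0<size = B , B∈ , m≤m+n (start B) 0 , +-monoʳ-< (start B) 0<size
blocks-runs-covering g (suc L) a {suc s} (s≤s s<L) with blocks-runs-covering (g ∘ suc) L (suc a) s<L
... | B , B∈ , from , to with blocks-consRun⁺ (g 0) (runs (applyUpTo (g ∘ suc) L)) a B∈
...   | B′ , B′∈ , start≤ , end≤ rewrite +-suc a s =
  B′ , B′∈ , ≤-trans start≤ from , <-≤-trans to end≤

fanPolygon : ∀ {k} → Fin (suc k) → Block → Polygon (suc k)
fanPolygon v (block c a m) = c , v ∷ applyUpTo (λ s → v ⊕ (a + s)) (suc m)

runPolygons≡map-fanPolygon : ∀ {k} (v : Fin (suc k)) a rs →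
  runPolygons v a rs ≡ map (fanPolygon v) (blocks a rs)
runPolygons≡map-fanPolygon v a []             = refl
runPolygons≡map-fanPolygon v a ((c , m) ∷ rs) = cong (_ ∷_) (runPolygons≡map-fanPolygon v (a + m) rs)

module _ {k : ℕ} {D : Rel₃ (Fin (suc k))} (v : Fin (suc k)) (a : ℕ) (rs : List (Color × ℕ)) where

  Cσ-runPolygons⊆ : (∀ {B} → B ∈ₗ blocks a rs → polyOrder (fanPolygon v B) ⊆₃ D) →
    Cσ (runPolygons v a rs) ⊆₃ D
  Cσ-runPolygons⊆ blocks⊆D x y z (P , P∈ , xyz)
    with ∈-map⁻ (fanPolygon v) (subst (P ∈ₗ_) (runPolygons≡map-fanPolygon v a rs) P∈)
  ... | B , B∈ , refl = blocks⊆D B∈ x y z xyz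

  Cσ-runPolygons⊆⁻ : Cσ (runPolygons v a rs) ⊆₃ D →
    ∀ {B} → B ∈ₗ blocks a rs → polyOrder (fanPolygon v B) ⊆₃ D
  Cσ-runPolygons⊆⁻ σ⊆D B∈ x y z xyz =
    σ⊆D x y z (_ , subst (_ ∈ₗ_) (sym (runPolygons≡map-fanPolygon v a rs)) (∈-map⁺ (fanPolygon v) B∈) , xyz)

∉⇒lookup≡false : ∀ {n} {J : Subset n} {x} → x ∉ J → Vec.lookup J x ≡ false
∉⇒lookup≡false {J = J} {x} x∉J = ¬-not (x∉J ∘ Vecₚ.lookup⇒[]= x J)

lookup≡false⇒∉ : ∀ {n} {J : Subset n} {x} → Vec.lookup J x ≡ false → x ∉ J
lookup≡false⇒∉ J[x]≡false x∈J = not-¬ (Vecₚ.[]=⇒lookup x∈J) J[x]≡false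

colour-injective : ∀ {b b′} → (if b then black else white) ≡ (if b′ then black else white) → b ≡ b′
colour-injective {true}  {true}  _ = refl
colour-injective {false} {false} _ = refl

module Kermit {k : ℕ} {C : Rel₃ (Fin (suc (suc k)))} (isTCO : IsTotalCyclicOrder C) (v : Fin (suc (suc k))) where
  open TotalCyclicOrder isTCO

  private
    Vertex : Set
    Vertex = Fin (suc (suc k))

  -- The colour of T_{t+1} = {v, v+t+1, v+t+2}.
  fanColour : Subset (suc (suc k)) → ℕ → Color
  fanColour J t = if Vec.lookup J (v ⊕ suc t) then black else white

  TriangleOriented : Subset (suc (suc k)) → ℕ → Set
  TriangleOriented J t = Oriented C (fanColour J t) v (v ⊕ suc t) (v ⊕ suc (suc t))

  FanOriented : Subset (suc (suc k)) → Set
  FanOriented J = ∀ t → t < k → TriangleOriented J t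

  fanOriented⇒kermit⊆ : ∀ J → FanOriented J → Cσ (kermit v J) ⊆₃ C
  fanOriented⇒kermit⊆ J fan = Cσ-runPolygons⊆ v 1 (runs (fanColors v J)) block⊆C
    where
    block⊆C : ∀ {B} → B ∈ₗ blocks 1 (runs (fanColors v J)) → polyOrder (fanPolygon v B) ⊆₃ C
    block⊆C {block c b m} B∈ with blocks-runs-monochromatic (fanColour J) k 1 B∈
    ... | o , refl , bound , mono = fan-oriented⇒polyOrder⊆ isTCO c v (λ s → v ⊕ (suc o + s)) edge
      where
      edge : ∀ s → s < m → Oriented C c v (v ⊕ suc (o + s)) (v ⊕ suc (o + suc s))
      edge s s<m =
        subst₂ (λ c′ t → Oriented C c′ v (v ⊕ suc (o + s)) (v ⊕ t)) (mono s s<m) (cong suc (sym (+-suc o s)))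
          (fan (o + s) (<-≤-trans (+-monoʳ-< o s<m) bound))

  kermit⊆⇒fanOriented : ∀ J → Cσ (kermit v J) ⊆₃ C → FanOriented J
  kermit⊆⇒fanOriented J σ⊆C t t<k with blocks-runs-covering (fanColour J) k 1 t<k
  ... | block c b m , B∈ , from , to with blocks-runs-monochromatic (fanColour J) k 1 B∈
  ...   | o , refl , _ , mono = subst (TriangleOriented J) o+s≡t triangle-o+s
    where
    s = t ∸ o
    o+s≡t : o + s ≡ t
    o+s≡t = m+[n∸m]≡n (≤-pred from)

    s<m : s < m
    s<m = +-cancelˡ-< o s m (subst (_< o + m) (sym o+s≡t) (≤-pred to))

    edge : Oriented C c v (v ⊕ suc (o + s)) (v ⊕ suc (o + suc s))
    edge = polyOrder⊆⇒fan-oriented isTCO c v (λ s → v ⊕ (suc o + s))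
             (Cσ-runPolygons⊆⁻ v 1 _ σ⊆C B∈) s s<m

    triangle-o+s : TriangleOriented J (o + s)
    triangle-o+s =
      subst₂ (λ c′ t′ → Oriented C c′ v (v ⊕ suc (o + s)) (v ⊕ t′)) (sym (mono s s<m)) (cong suc (+-suc o s)) edge

  -- Degenerate triples count as not reversed: this keeps v and v−1 out of `chosen`.
  reversed : Vertex → Vertex → Vertex → Bool
  reversed a b c with a ≟ b | b ≟ c | a ≟ c
  ... | no a≢b | no b≢c | no a≢c = Sum.[ (λ _ → false) , (λ _ → true) ]′ (total a b c a≢b b≢c a≢c)
  ... | _      | _      | _      = false

  oriented-reversed : ∀ {a b c} → ¬ a ≡ b → ¬ b ≡ c → ¬ a ≡ c →
    Oriented C (if reversed a b c then black else white) a b c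
  oriented-reversed {a} {b} {c} a≢b b≢c a≢c with a ≟ b | b ≟ c | a ≟ c
  ... | yes a≡b | _       | _       = ⊥-elim (a≢b a≡b)
  ... | no _    | yes b≡c | _       = ⊥-elim (b≢c b≡c)
  ... | no _    | no _    | yes a≡c = ⊥-elim (a≢c a≡c)
  ... | no p    | no q    | no r with total a b c p q r
  ...   | inj₁ abc = abc
  ...   | inj₂ acb = acb

  reversed-degenerate₁₂ : ∀ a c → reversed a a c ≡ false
  reversed-degenerate₁₂ a c with a ≟ a
  ... | yes _   = refl
  ... | no a≢a = ⊥-elim (a≢a refl)

  reversed-degenerate₁₃ : ∀ a b → reversed a b a ≡ false
  reversed-degenerate₁₃ a b with a ≟ b | b ≟ a | a ≟ a
  ... | yes _ | _     | _       = refl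
  ... | no _  | yes _ | _       = refl
  ... | no _  | no _  | yes _   = refl
  ... | no _  | no _  | no a≢a = ⊥-elim (a≢a refl)

  chosen : Subset (suc (suc k))
  chosen = Vec.tabulate (λ x → reversed v x (x ⊕ 1))

  lookup-chosen : ∀ x → Vec.lookup chosen x ≡ reversed v x (x ⊕ 1)
  lookup-chosen = Vecₚ.lookup∘tabulate (λ x → reversed v x (x ⊕ 1))

  v∉chosen : v ∉ chosen
  v∉chosen = lookup≡false⇒∉ (trans (lookup-chosen v) (reversed-degenerate₁₂ v (v ⊕ 1)))

  predMod∉chosen : predMod v ∉ chosen
  predMod∉chosen = lookup≡false⇒∉ (begin
    Vec.lookup chosen (predMod v)                  ≡⟨ lookup-chosen (predMod v) ⟩
    reversed v (predMod v) (predMod v ⊕ 1)         ≡⟨ cong (reversed v (predMod v)) (predMod-⊕1 v) ⟩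
    reversed v (predMod v) v                       ≡⟨ reversed-degenerate₁₃ v (predMod v) ⟩
    false                                          ∎)
    where open ≡-Reasoning

  chosen-fanOriented : FanOriented chosen
  chosen-fanOriented t t<k =
    subst₂ (λ b y → Oriented C (if b then black else white) v x y)
      (sym (lookup-chosen x)) (⊕-suc v (suc t))
      (oriented-reversed v≢x x≢x⊕1 v≢x⊕1)
    where
    x = v ⊕ suc t
    1+t<n : suc t < suc (suc k)
    1+t<n = s≤s (s≤s (<⇒≤ t<k))
    2+t<n : suc (suc t) < suc (suc k)
    2+t<n = s≤s (s≤s t<k)

    v≢x : ¬ v ≡ x
    v≢x = ⊕-distinct v (s≤s z≤n) 1+t<n ∘ trans (⊕-zero v)
    x≢x⊕1 : ¬ x ≡ x ⊕ 1
    x≢x⊕1 e = ⊕-distinct v (n<1+n (suc t)) 2+t<n (trans e (⊕-suc v (suc t)))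
    v≢x⊕1 : ¬ v ≡ x ⊕ 1
    v≢x⊕1 e = ⊕-distinct v (s≤s z≤n) 2+t<n (trans (⊕-zero v) (trans e (⊕-suc v (suc t))))

  fanOriented-unique : ∀ J J′ → FanOriented J → FanOriented J′ →
    ∀ t → t < k → Vec.lookup J (v ⊕ suc t) ≡ Vec.lookup J′ (v ⊕ suc t)
  fanOriented-unique J J′ fan fan′ t t<k = colour-injective (Oriented-unique (fan t t<k) (fan′ t t<k))

  vertex-cases : ∀ x → x ≡ v ⊎ x ≡ predMod v ⊎ ∃[ t ] (t < k × x ≡ v ⊕ suc t)
  vertex-cases x with offset v x | ⊕-offset v x | offset<n v x
  ... | zero  | v⊕0≡x | _ = inj₁ (trans (sym v⊕0≡x) (⊕-zero v))
  ... | suc t | v⊕t≡x | s≤s (s≤s t≤k) with m≤n⇒m<n∨m≡n t≤k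
  ...   | inj₁ t<k  = inj₂ (inj₂ (t , t<k , sym v⊕t≡x))
  ...   | inj₂ refl = inj₂ (inj₁ (sym v⊕t≡x))

  ≡-from-fan-vertices : ∀ {J J′} → v ∉ J → predMod v ∉ J → v ∉ J′ → predMod v ∉ J′ →
    (∀ t → t < k → Vec.lookup J (v ⊕ suc t) ≡ Vec.lookup J′ (v ⊕ suc t)) → J ≡ J′
  ≡-from-fan-vertices {J} {J′} v∉J p∉J v∉J′ p∉J′ agree-on-fan =
    trans (sym (Vecₚ.tabulate∘lookup J)) (trans (Vecₚ.tabulate-cong agree) (Vecₚ.tabulate∘lookup J′))
    where
    agree : ∀ x → Vec.lookup J x ≡ Vec.lookup J′ x
    agree x with vertex-cases x
    ... | inj₁ refl                    = trans (∉⇒lookup≡false v∉J) (sym (∉⇒lookup≡false v∉J′))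
    ... | inj₂ (inj₁ refl)             = trans (∉⇒lookup≡false p∉J) (sym (∉⇒lookup≡false p∉J′))
    ... | inj₂ (inj₂ (t , t<k , refl)) = agree-on-fan t t<k

  unique-kermit-extension :
    ∃[ I ] ((predMod v ∉ I) × (v ∉ I) × IsCircularExtensionOf C (Cσ (kermit v I))
      × ((J : Subset (suc (suc k))) → predMod v ∉ J → v ∉ J →
           IsCircularExtensionOf C (Cσ (kermit v J)) → J ≡ I))
  unique-kermit-extension =
    chosen , predMod∉chosen , v∉chosen , (isTCO , fanOriented⇒kermit⊆ chosen chosen-fanOriented) ,
    λ J p∉J v∉J (_ , J⊆C) → ≡-from-fan-vertices v∉J p∉J v∉chosen predMod∉chosen
      (fanOriented-unique J chosen (kermit⊆⇒fanOriented J J⊆C) chosen-fanOriented)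

-- w ∈ D_n is unused: in the paper it only makes w ↦ C_w a bijection onto total cyclic orders.
corollary4p11 : (m : ℕ) → let n = suc (suc (suc m)) in
    (w : Permutation′ n) → InD w → (v : Fin n) →
    ∃[ I ] ((predMod v ∉ I) × (v ∉ I) × IsCircularExtensionOf (Cw w) (Cσ (kermit v I))
      × ((J : Subset n) → predMod v ∉ J → v ∉ J →
           IsCircularExtensionOf (Cw w) (Cσ (kermit v J)) → J ≡ I))
corollary4p11 m w _ v = Kermit.unique-kermit-extension (Cw-isTotalCyclicOrder w) v
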